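{- Let $n \ge 0$. If $A_{\mathbb{Z}[i],n} = B_n$, then $A_{\mathbb{Z}[i],n+1} \subset B_{n+1}$.
   Context: $A_{\mathbb{Z}[i],0} = \{0,\pm 1,\pm i\}$, and for $n\ge 1$, $A_{\mathbb{Z}[i],n} = A_{\mathbb{Z}[i],n-1} \cup \{\beta \in \mathbb{Z}[i] : \text{every residue class of } \mathbb{Z}[i]/(\beta) \text{ has a representative in } A_{\mathbb{Z}[i],n-1}\}$. For $n\ge 0$, $B_n = \left\{ \sum_{j=0}^n v_j (1+i)^j : v_j \in \{0,\pm 1,\pm i\}\right\}$. -}

module Defs where

open import Data.Nat using (ℕ; zero; suc)
open import Data.Integer as ℤ using (ℤ; +_; -[1+_])
open import Data.Vec using (Vec; []; _∷_)
open import Data.Vec.Relation.Unary.All using (All)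
open import Data.Product using (Σ; _×_; ∃; ∃-syntax)
open import Data.Sum using (_⊎_)
open import Relation.Binary.PropositionalEquality using (_≡_)

record ℤ[i] : Set where
  constructor _+_i
  field
    re : ℤ
    im : ℤ
open ℤ[i] public

infixl 6 _⊕_ _⊖_
infixl 7 _⊗_

_⊕_ : ℤ[i] → ℤ[i] → ℤ[i]
(a + b i) ⊕ (c + d i) = (a ℤ.+ c) + (b ℤ.+ d) i

⊝_ : ℤ[i] → ℤ[i]
⊝ (a + b i) = (ℤ.- a) + (ℤ.- b) i

_⊖_ : ℤ[i] → ℤ[i] → ℤ[i]
x ⊖ y = x ⊕ (⊝ y)

_⊗_ : ℤ[i] → ℤ[i] → ℤ[i]
(a + b i) ⊗ (c + d i) = (a ℤ.* c ℤ.- b ℤ.* d) + (a ℤ.* d ℤ.+ b ℤ.* c) i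

𝟘 𝟙 -𝟙 𝕚 -𝕚 : ℤ[i]
𝟘  = (+ 0) + (+ 0) i
𝟙  = (+ 1) + (+ 0) i
-𝟙 = -[1+ 0 ] + (+ 0) i
𝕚  = (+ 0) + (+ 1) i
-𝕚 = (+ 0) + -[1+ 0 ] i

ω : ℤ[i]
ω = (+ 1) + (+ 1) i

_^_ : ℤ[i] → ℕ → ℤ[i]
x ^ zero  = 𝟙
x ^ suc k = x ⊗ (x ^ k)

_∣_ : ℤ[i] → ℤ[i] → Set
β ∣ γ = ∃[ κ ] γ ≡ β ⊗ κ

Digit : ℤ[i] → Set
Digit z = z ≡ 𝟘 ⊎ z ≡ 𝟙 ⊎ z ≡ -𝟙 ⊎ z ≡ 𝕚 ⊎ z ≡ -𝕚

A : ℕ → ℤ[i] → Set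
A zero    z = Digit z
A (suc n) β = A n β ⊎ (∀ (γ : ℤ[i]) → ∃[ α ] (A n α × β ∣ (γ ⊖ α)))
  -- every residue class γ + (β) of ℤ[i]/(β) contains some α ∈ A_{n}

evalFrom : ∀ {m} → ℕ → Vec ℤ[i] m → ℤ[i]
evalFrom k []       = 𝟘
evalFrom k (v ∷ vs) = (v ⊗ (ω ^ k)) ⊕ evalFrom (suc k) vs

B : ℕ → ℤ[i] → Set
B n z = Σ (Vec ℤ[i] (suc n)) λ v → All Digit v × evalFrom 0 v ≡ z

{-# OPTIONS --safe #-}
-- Let β ∈ A (suc n) ∖ A n, so that every residue class modulo β meets A n = B n. Two facts about
-- B n carry the argument. It contains the disc N z ≤ 2ⁿ⁺¹ - 1: peel off a digit d ≡ z (mod ω),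
-- choosing the unit d aligned with z, so that the norm of (z - d) / ω is at most half that of z.
-- And it lies in an octagon |x|, |y| ≤ M, |x| + |y| ≤ S whose size doubles every two digits.
-- If β = ω δ, the classes of multiples of ω can only contain elements with last digit 0, so δ has
-- the covering property one level lower and β = 0 + ω δ ∈ B (suc n) by induction.
-- If β is odd, take α ∈ B n in the class of ω / 2 modulo β; then β (ω - 2κ) = 2α - ω for some κ.
-- Either ω - 2κ is a unit multiple of ω, and dividing by ω exhibits β as a unit times
-- -1 + ω (-i α) ∈ B (suc n); or N (ω - 2κ) ≥ 10, and the octagon bound N (2α - ω) < 10 · 2ⁿ⁺²
-- gives N β ≤ 2ⁿ⁺² - 1, so β ∈ B (suc n) by the disc lemma.
module Submission where

open import Defs
open import Data.Nat as ℕ using (ℕ; zero; suc; z≤n; s≤s)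
import Data.Nat.Properties as ℕP
open import Data.Integer using (ℤ; +_; -[1+_]; _+_; _*_; _-_; -_; _≤_; _≤?_; +≤+; -≤+; nonNegative; ∣_∣; _/_; _%_)
import Data.Integer.Properties as ℤP
open import Data.Integer.DivMod using (a≡a%n+[a/n]*n; n%d<d)
open import Data.Integer.Tactic.RingSolver using (solve-∀)
import Tactic.RingSolver as RingSolver
open import Tactic.RingSolver.Core.AlmostCommutativeRing using (AlmostCommutativeRing; fromCommutativeRing)
open import Algebra.Bundles using (CommutativeRing)
open import Data.Vec using (Vec; []; _∷_)
open import Data.Vec.Relation.Unary.All using ([]; _∷_)
open import Data.Empty using (⊥-elim)
open import Data.Maybe using (Maybe; just; nothing)
open import Data.Product using (_×_; _,_; ∃-syntax; proj₁; proj₂)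
open import Data.Sum using (_⊎_; inj₁; inj₂)
open import Relation.Nullary using (yes; no)
open import Relation.Binary.PropositionalEquality
open import Algebra.Structures {A = ℤ[i]} _≡_ using (IsCommutativeRing)

square-nonNeg : ∀ a → + 0 ≤ a * a
square-nonNeg (+ zero)  = +≤+ z≤n
square-nonNeg (+ suc n) = +≤+ z≤n
square-nonNeg -[1+ n ]  = +≤+ z≤n

square≤0⇒≡0 : ∀ a → a * a ≤ + 0 → a ≡ + 0
square≤0⇒≡0 (+ zero) _ = refl
square≤0⇒≡0 (+ suc n) (+≤+ ())
square≤0⇒≡0 -[1+ n ] (+≤+ ())

double-injective : ∀ {a c} → a + a ≡ c + c → a ≡ c
double-injective {a} {c} eq = ℤP.*-cancelˡ-≡ (+ 2) a c (begin
  + 2 * a ≡⟨ double a ⟩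
  a + a   ≡⟨ eq ⟩
  c + c   ≡⟨ double c ⟨
  + 2 * c ∎)
  where
  open ≡-Reasoning
  double : ∀ a → + 2 * a ≡ a + a
  double = solve-∀

even-or-odd : ∀ a → (∃[ q ] a ≡ q + q) ⊎ (∃[ q ] a ≡ + 1 + (q + q))
even-or-odd a with a % + 2 | n%d<d a (+ 2) | a≡a%n+[a/n]*n a (+ 2)
... | 0           | _             | eq = inj₁ (a / + 2 , trans eq (even (a / + 2)))
  where
  even : ∀ q → + 0 + q * + 2 ≡ q + q
  even = solve-∀
... | 1           | _             | eq = inj₂ (a / + 2 , trans eq (odd (a / + 2)))
  where
  odd : ∀ q → + 1 + q * + 2 ≡ + 1 + (q + q)
  odd = solve-∀
... | suc (suc _) | s≤s (s≤s ()) | _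

mul-mono-nonNeg : ∀ {p p′ q q′} → + 0 ≤ p → + 0 ≤ q → p ≤ p′ → q ≤ q′ → p * q ≤ p′ * q′
mul-mono-nonNeg {p} {p′} {q} {q′} 0≤p 0≤q p≤p′ q≤q′ = ℤP.≤-trans
  (ℤP.*-monoʳ-≤-nonNeg q {{nonNegative 0≤q}} p≤p′)
  (ℤP.*-monoˡ-≤-nonNeg p′ {{nonNegative (ℤP.≤-trans 0≤p p≤p′)}} q≤q′)

square-mono : ∀ {a b} → + 0 ≤ a → a ≤ b → a * a ≤ b * b
square-mono 0≤a a≤b = mul-mono-nonNeg 0≤a 0≤a a≤b a≤b

≤-by-gap : ∀ {a b} g → + 0 ≤ g → b ≡ a + g → a ≤ b
≤-by-gap {a} g 0≤g refl = ℤP.i≤i+j a g {{nonNegative 0≤g}}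

scaled-≤⇒≤ : ∀ m {a r} → + suc m * a ≤ + suc m * r + + m → a ≤ r
scaled-≤⇒≤ m {a} {r} h with a ≤? r
... | yes a≤r = a≤r
... | no  a≰r = ⊥-elim (ℤP.<-irrefl refl (ℤP.suc[i]≤j⇒i<j (begin
  + 1 + (+ suc m * r + + m)  ≡⟨ expand (+ m) r ⟨
  + suc m * (+ 1 + r)        ≤⟨ ℤP.*-monoˡ-≤-nonNeg (+ suc m) (ℤP.i<j⇒suc[i]≤j (ℤP.≰⇒> a≰r)) ⟩
  + suc m * a                ≤⟨ h ⟩
  + suc m * r + + m          ∎)))
  where
  open ℤP.≤-Reasoning
  expand : ∀ m r → (+ 1 + m) * (+ 1 + r) ≡ + 1 + ((+ 1 + m) * r + m)
  expand = solve-∀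

-- The commutative ring ℤ[i]

⊕-assoc : ∀ x y z → (x ⊕ y) ⊕ z ≡ x ⊕ (y ⊕ z)
⊕-assoc (a + b i) (c + d i) (e + f i) = cong₂ _+_i (ℤP.+-assoc a c e) (ℤP.+-assoc b d f)

⊕-comm : ∀ x y → x ⊕ y ≡ y ⊕ x
⊕-comm (a + b i) (c + d i) = cong₂ _+_i (ℤP.+-comm a c) (ℤP.+-comm b d)

⊕-identityˡ : ∀ x → 𝟘 ⊕ x ≡ x
⊕-identityˡ (a + b i) = cong₂ _+_i (ℤP.+-identityˡ a) (ℤP.+-identityˡ b)

⊕-identityʳ : ∀ x → x ⊕ 𝟘 ≡ x
⊕-identityʳ (a + b i) = cong₂ _+_i (ℤP.+-identityʳ a) (ℤP.+-identityʳ b)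

⊝-inverseˡ : ∀ x → (⊝ x) ⊕ x ≡ 𝟘
⊝-inverseˡ (a + b i) = cong₂ _+_i (ℤP.+-inverseˡ a) (ℤP.+-inverseˡ b)

⊝-inverseʳ : ∀ x → x ⊕ (⊝ x) ≡ 𝟘
⊝-inverseʳ (a + b i) = cong₂ _+_i (ℤP.+-inverseʳ a) (ℤP.+-inverseʳ b)

⊗-assoc : ∀ x y z → (x ⊗ y) ⊗ z ≡ x ⊗ (y ⊗ z)
⊗-assoc (a + b i) (c + d i) (e + f i) = cong₂ _+_i (re≡ a b c d e f) (im≡ a b c d e f)
  where
  re≡ : ∀ a b c d e f → (a * c - b * d) * e - (a * d + b * c) * f ≡ a * (c * e - d * f) - b * (c * f + d * e)
  re≡ = solve-∀
  im≡ : ∀ a b c d e f → (a * c - b * d) * f + (a * d + b * c) * e ≡ a * (c * f + d * e) + b * (c * e - d * f)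
  im≡ = solve-∀

⊗-comm : ∀ x y → x ⊗ y ≡ y ⊗ x
⊗-comm (a + b i) (c + d i) = cong₂ _+_i (re≡ a b c d) (im≡ a b c d)
  where
  re≡ : ∀ a b c d → a * c - b * d ≡ c * a - d * b
  re≡ = solve-∀
  im≡ : ∀ a b c d → a * d + b * c ≡ c * b + d * a
  im≡ = solve-∀

⊗-identityˡ : ∀ x → 𝟙 ⊗ x ≡ x
⊗-identityˡ (a + b i) = cong₂ _+_i (re≡ a b) (im≡ a b)
  where
  re≡ : ∀ a b → + 1 * a - + 0 * b ≡ a
  re≡ = solve-∀
  im≡ : ∀ a b → + 1 * b + + 0 * a ≡ b
  im≡ = solve-∀

⊗-identityʳ : ∀ x → x ⊗ 𝟙 ≡ x
⊗-identityʳ x = trans (⊗-comm x 𝟙) (⊗-identityˡ x)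

⊗-distribʳ : ∀ x y z → (y ⊕ z) ⊗ x ≡ y ⊗ x ⊕ z ⊗ x
⊗-distribʳ (a + b i) (c + d i) (e + f i) = cong₂ _+_i (re≡ a b c d e f) (im≡ a b c d e f)
  where
  re≡ : ∀ a b c d e f → (c + e) * a - (d + f) * b ≡ (c * a - d * b) + (e * a - f * b)
  re≡ = solve-∀
  im≡ : ∀ a b c d e f → (c + e) * b + (d + f) * a ≡ (c * b + d * a) + (e * b + f * a)
  im≡ = solve-∀

⊗-distribˡ : ∀ x y z → x ⊗ (y ⊕ z) ≡ x ⊗ y ⊕ x ⊗ z
⊗-distribˡ x y z = begin
  x ⊗ (y ⊕ z)     ≡⟨ ⊗-comm x (y ⊕ z) ⟩
  (y ⊕ z) ⊗ x     ≡⟨ ⊗-distribʳ x y z ⟩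
  y ⊗ x ⊕ z ⊗ x   ≡⟨ cong₂ _⊕_ (⊗-comm y x) (⊗-comm z x) ⟩
  x ⊗ y ⊕ x ⊗ z   ∎
  where open ≡-Reasoning

ℤ[i]-isCommutativeRing : IsCommutativeRing _⊕_ _⊗_ ⊝_ 𝟘 𝟙
ℤ[i]-isCommutativeRing = record
  { isRing = record
    { +-isAbelianGroup = record
      { isGroup = record
        { isMonoid = record
          { isSemigroup = record
            { isMagma = record { isEquivalence = isEquivalence ; ∙-cong = cong₂ _⊕_ }
            ; assoc   = ⊕-assoc
            }
          ; identity = ⊕-identityˡ , ⊕-identityʳ
          }
        ; inverse = ⊝-inverseˡ , ⊝-inverseʳ
        ; ⁻¹-cong = cong ⊝_
        }
      ; comm = ⊕-comm
      }
    ; *-cong     = cong₂ _⊗_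
    ; *-assoc    = ⊗-assoc
    ; *-identity = ⊗-identityˡ , ⊗-identityʳ
    ; distrib    = ⊗-distribˡ , ⊗-distribʳ
    }
  ; *-comm = ⊗-comm
  }

ℤ[i]-commutativeRing : CommutativeRing _ _
ℤ[i]-commutativeRing = record { isCommutativeRing = ℤ[i]-isCommutativeRing }

𝟘≟_ : ∀ x → Maybe (𝟘 ≡ x)
𝟘≟ ((+ 0) + (+ 0) i) = just refl
𝟘≟ _                 = nothing

-- The solver compares normal forms syntactically, so it must recognise zero coefficients
-- such as 𝟘 or 𝕚 ⊗ 𝕚 ⊕ 𝟙 in order to drop them.
ℤ[i]-ring : AlmostCommutativeRing _ _
ℤ[i]-ring = fromCommutativeRing ℤ[i]-commutativeRing 𝟘≟_

⊗-zeroˡ : ∀ x → 𝟘 ⊗ x ≡ 𝟘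
⊗-zeroˡ = RingSolver.solve-∀ ℤ[i]-ring

⊗-zeroʳ : ∀ x → x ⊗ 𝟘 ≡ 𝟘
⊗-zeroʳ = RingSolver.solve-∀ ℤ[i]-ring

norm : ℤ[i] → ℤ
norm (a + b i) = a * a + b * b

norm-nonNeg : ∀ z → + 0 ≤ norm z
norm-nonNeg (a + b i) = ℤP.+-mono-≤ (square-nonNeg a) (square-nonNeg b)

norm-⊗ : ∀ x y → norm (x ⊗ y) ≡ norm x * norm y
norm-⊗ (a + b i) (c + d i) = identity a b c d
  where
  identity : ∀ a b c d → (a * c - b * d) * (a * c - b * d) + (a * d + b * c) * (a * d + b * c)
                       ≡ (a * a + b * b) * (c * c + d * d)
  identity = solve-∀

norm≤0⇒≡𝟘 : ∀ z → norm z ≤ + 0 → z ≡ 𝟘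
norm≤0⇒≡𝟘 (a + b i) h = cong₂ _+_i
  (square≤0⇒≡0 a (ℤP.≤-trans (ℤP.i≤i+j (a * a) (b * b) {{nonNegative (square-nonNeg b)}}) h))
  (square≤0⇒≡0 b (ℤP.≤-trans (ℤP.i≤j+i (b * b) (a * a) {{nonNegative (square-nonNeg a)}}) h))

Unit : ℤ[i] → Set
Unit u = u ≡ 𝟙 ⊎ u ≡ -𝟙 ⊎ u ≡ 𝕚 ⊎ u ≡ -𝕚

pattern is-𝟙  = inj₁ refl
pattern is--𝟙 = inj₂ (inj₁ refl)
pattern is-𝕚  = inj₂ (inj₂ (inj₁ refl))
pattern is--𝕚 = inj₂ (inj₂ (inj₂ refl))

-- Digit z unfolds to  z ≡ 𝟘 ⊎ Unit z.
pattern is-𝟘  = inj₁ refl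

norm-unit : ∀ {u} → Unit u → norm u ≡ + 1
norm-unit is-𝟙  = refl
norm-unit is--𝟙 = refl
norm-unit is-𝕚  = refl
norm-unit is--𝕚 = refl

norm-⊗-unit : ∀ {u} z → Unit u → norm (u ⊗ z) ≡ norm z
norm-⊗-unit {u} z unit = begin
  norm (u ⊗ z)      ≡⟨ norm-⊗ u z ⟩
  norm u * norm z   ≡⟨ cong (_* norm z) (norm-unit unit) ⟩
  + 1 * norm z      ≡⟨ ℤP.*-identityˡ (norm z) ⟩
  norm z            ∎
  where open ≡-Reasoning

Unit-⊗ : ∀ {u v} → Unit u → Unit v → Unit (u ⊗ v)
Unit-⊗ is-𝟙  is-𝟙  = is-𝟙
Unit-⊗ is-𝟙  is--𝟙 = is--𝟙
Unit-⊗ is-𝟙  is-𝕚  = is-𝕚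
Unit-⊗ is-𝟙  is--𝕚 = is--𝕚
Unit-⊗ is--𝟙 is-𝟙  = is--𝟙
Unit-⊗ is--𝟙 is--𝟙 = is-𝟙
Unit-⊗ is--𝟙 is-𝕚  = is--𝕚
Unit-⊗ is--𝟙 is--𝕚 = is-𝕚
Unit-⊗ is-𝕚  is-𝟙  = is-𝕚
Unit-⊗ is-𝕚  is--𝟙 = is--𝕚
Unit-⊗ is-𝕚  is-𝕚  = is--𝟙
Unit-⊗ is-𝕚  is--𝕚 = is-𝟙
Unit-⊗ is--𝕚 is-𝟙  = is--𝕚
Unit-⊗ is--𝕚 is--𝟙 = is-𝕚
Unit-⊗ is--𝕚 is-𝕚  = is-𝟙
Unit-⊗ is--𝕚 is--𝕚 = is--𝟙

Digit-⊗ : ∀ {u d} → Digit u → Digit d → Digit (u ⊗ d)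
Digit-⊗ {d = d} is-𝟘 _        = inj₁ (⊗-zeroˡ d)
Digit-⊗ {u = u} (inj₂ _) is-𝟘 = inj₁ (⊗-zeroʳ u)
Digit-⊗ (inj₂ u) (inj₂ d) = inj₂ (Unit-⊗ u d)

Unit-inverse : ∀ {u} → Unit u → ∃[ v ] Unit v × v ⊗ u ≡ 𝟙
Unit-inverse is-𝟙  = 𝟙 , is-𝟙 , refl
Unit-inverse is--𝟙 = -𝟙 , is--𝟙 , refl
Unit-inverse is-𝕚  = -𝕚 , is--𝕚 , refl
Unit-inverse is--𝕚 = 𝕚 , is-𝕚 , refl

Unit-≡𝟙-mod-ω : ∀ {u} → Unit u → ∃[ c ] 𝟙 ≡ u ⊕ ω ⊗ c
Unit-≡𝟙-mod-ω is-𝟙  = 𝟘 , refl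
Unit-≡𝟙-mod-ω is--𝟙 = (+ 1) + -[1+ 0 ] i , refl
Unit-≡𝟙-mod-ω is-𝕚  = -𝕚 , refl
Unit-≡𝟙-mod-ω is--𝕚 = 𝟙 , refl

ω∤𝟙 : ∀ c → 𝟙 ≢ ω ⊗ c
ω∤𝟙 c eq = ℕP.even≢odd ∣ norm c ∣ 0 (sym (begin
  1                    ≡⟨ cong (λ z → ∣ norm z ∣) eq ⟩
  ∣ norm (ω ⊗ c) ∣     ≡⟨ cong ∣_∣ (norm-⊗ ω c) ⟩
  ∣ + 2 * norm c ∣     ≡⟨ ℤP.abs-* (+ 2) (norm c) ⟩
  2 ℕ.* ∣ norm c ∣     ∎))
  where open ≡-Reasoning

ω∣digit⇒≡𝟘 : ∀ {d} c → Digit d → d ≡ ω ⊗ c → d ≡ 𝟘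
ω∣digit⇒≡𝟘 c is-𝟘 _ = refl
ω∣digit⇒≡𝟘 {d} c (inj₂ unit) d≡ωc with Unit-≡𝟙-mod-ω unit
... | c′ , 𝟙≡d+ωc′ = ⊥-elim (ω∤𝟙 (c ⊕ c′) (begin
  𝟙                  ≡⟨ 𝟙≡d+ωc′ ⟩
  d ⊕ ω ⊗ c′         ≡⟨ cong (_⊕ ω ⊗ c′) d≡ωc ⟩
  ω ⊗ c ⊕ ω ⊗ c′     ≡⟨ ⊗-distribˡ ω c c′ ⟨
  ω ⊗ (c ⊕ c′)       ∎))
  where open ≡-Reasoning

ω̄ : ℤ[i]
ω̄ = (+ 1) + -[1+ 0 ] i

ω⊗-cancelˡ : ∀ {x y} → ω ⊗ x ≡ ω ⊗ y → x ≡ y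
ω⊗-cancelˡ {a + b i} {c + d i} eq =
  cong₂ _+_i (double-injective (cong re doubled)) (double-injective (cong im doubled))
  where
  open ≡-Reasoning
  double-as-product : ∀ x → x ⊕ x ≡ ω̄ ⊗ (ω ⊗ x)
  double-as-product = RingSolver.solve-∀ ℤ[i]-ring
  doubled : (a + b i) ⊕ (a + b i) ≡ (c + d i) ⊕ (c + d i)
  doubled = begin
    (a + b i) ⊕ (a + b i)   ≡⟨ double-as-product (a + b i) ⟩
    ω̄ ⊗ (ω ⊗ (a + b i))     ≡⟨ cong (ω̄ ⊗_) eq ⟩
    ω̄ ⊗ (ω ⊗ (c + d i))     ≡⟨ double-as-product (c + d i) ⟨
    (c + d i) ⊕ (c + d i)   ∎

ω∣-if-even : ∀ {x y} q → x + y ≡ q + q → x + y i ≡ ω ⊗ (q + (q - x) i)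
ω∣-if-even {x} {y} q x+y≡q+q = cong₂ _+_i (re≡ x q) (begin
  y                      ≡⟨ solve-y x y ⟩
  (x + y) - x            ≡⟨ cong (_- x) x+y≡q+q ⟩
  (q + q) - x            ≡⟨ im≡ x q ⟩
  + 1 * (q - x) + + 1 * q ∎)
  where
  open ≡-Reasoning
  re≡ : ∀ x q → x ≡ + 1 * q - + 1 * (q - x)
  re≡ = solve-∀
  solve-y : ∀ x y → y ≡ (x + y) - x
  solve-y = solve-∀
  im≡ : ∀ x q → (q + q) - x ≡ + 1 * (q - x) + + 1 * q
  im≡ = solve-∀

ω-split : ∀ z → (∃[ w ] z ≡ ω ⊗ w) ⊎ (∃[ w ] z ≡ 𝟙 ⊕ ω ⊗ w)
ω-split (x + y i) with even-or-odd (x + y)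
... | inj₁ (q , x+y≡q+q)   = inj₁ (q + (q - x) i , ω∣-if-even q x+y≡q+q)
... | inj₂ (q , x+y≡1+q+q) = inj₂ (q + (q - (x - + 1)) i , (begin
  x + y i                   ≡⟨ cong₂ _+_i (shift x) (sym (ℤP.+-identityˡ y)) ⟩
  𝟙 ⊕ ((x - + 1) + y i)     ≡⟨ cong (𝟙 ⊕_) (ω∣-if-even q x-1+y≡q+q) ⟩
  𝟙 ⊕ ω ⊗ (q + (q - (x - + 1)) i) ∎))
  where
  open ≡-Reasoning
  shift : ∀ x → x ≡ + 1 + (x - + 1)
  shift = solve-∀
  regroup : ∀ x y → (x - + 1) + y ≡ (x + y) - + 1
  regroup = solve-∀
  cancel : ∀ q → + 1 + (q + q) - + 1 ≡ q + q
  cancel = solve-∀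
  x-1+y≡q+q : (x - + 1) + y ≡ q + q
  x-1+y≡q+q = begin
    (x - + 1) + y        ≡⟨ regroup x y ⟩
    (x + y) - + 1        ≡⟨ cong (_- + 1) x+y≡1+q+q ⟩
    + 1 + (q + q) - + 1  ≡⟨ cancel q ⟩
    q + q                ∎

evalFrom-suc : ∀ {m} k (v : Vec ℤ[i] m) → evalFrom (suc k) v ≡ ω ⊗ evalFrom k v
evalFrom-suc k []      = refl
evalFrom-suc k (x ∷ v) = begin
  x ⊗ (ω ⊗ ω ^ k) ⊕ evalFrom (suc (suc k)) v  ≡⟨ cong (x ⊗ (ω ⊗ ω ^ k) ⊕_) (evalFrom-suc (suc k) v) ⟩
  x ⊗ (ω ⊗ ω ^ k) ⊕ ω ⊗ evalFrom (suc k) v    ≡⟨ factor-ω x (ω ^ k) (evalFrom (suc k) v) ⟩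
  ω ⊗ (x ⊗ ω ^ k ⊕ evalFrom (suc k) v)        ∎
  where
  open ≡-Reasoning
  factor-ω : ∀ x p q → x ⊗ (ω ⊗ p) ⊕ ω ⊗ q ≡ ω ⊗ (x ⊗ p ⊕ q)
  factor-ω = RingSolver.solve-∀ ℤ[i]-ring

evalFrom-cons : ∀ {m} d (v : Vec ℤ[i] m) → evalFrom 0 (d ∷ v) ≡ d ⊕ ω ⊗ evalFrom 0 v
evalFrom-cons d v = cong₂ _⊕_ (⊗-identityʳ d) (evalFrom-suc 0 v)

B-cons : ∀ {n d w} → Digit d → B n w → B (suc n) (d ⊕ ω ⊗ w)
B-cons {d = d} d-digit (v , v-digits , refl) = d ∷ v , d-digit ∷ v-digits , evalFrom-cons d v

B-uncons : ∀ {n z} → B (suc n) z → ∃[ d ] ∃[ w ] Digit d × B n w × z ≡ d ⊕ ω ⊗ w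
B-uncons (d ∷ v , d-digit ∷ v-digits , refl) =
  d , evalFrom 0 v , d-digit , (v , v-digits , refl) , evalFrom-cons d v

evalFrom-singleton : ∀ d → evalFrom 0 (d ∷ []) ≡ d
evalFrom-singleton d = trans (⊕-identityʳ (d ⊗ 𝟙)) (⊗-identityʳ d)

Digit⇒B0 : ∀ {d} → Digit d → B 0 d
Digit⇒B0 {d} d-digit = d ∷ [] , d-digit ∷ [] , evalFrom-singleton d

B0⇒Digit : ∀ {z} → B 0 z → Digit z
B0⇒Digit (d ∷ [] , d-digit ∷ [] , refl) = subst Digit (sym (evalFrom-singleton d)) d-digit

B-ω⊗ : ∀ {n z} → B n z → B (suc n) (ω ⊗ z)
B-ω⊗ {z = z} z∈B = subst (B _) (⊕-identityˡ (ω ⊗ z)) (B-cons is-𝟘 z∈B)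

⊕-ω⊗𝟘 : ∀ z → z ⊕ ω ⊗ 𝟘 ≡ z
⊕-ω⊗𝟘 = RingSolver.solve-∀ ℤ[i]-ring

B-mono : ∀ {n z} → B n z → B (suc n) z
B-mono {zero} {z} z∈B = subst (B 1) (⊕-ω⊗𝟘 z) (B-cons (B0⇒Digit z∈B) (Digit⇒B0 is-𝟘))
B-mono {suc n} z∈B with B-uncons z∈B
... | d , w , d-digit , w∈B , refl = B-cons d-digit (B-mono w∈B)

B-⊗-digit : ∀ {n u z} → Digit u → B n z → B n (u ⊗ z)
B-⊗-digit {zero}  u-digit z∈B = Digit⇒B0 (Digit-⊗ u-digit (B0⇒Digit z∈B))
B-⊗-digit {suc n} {u} u-digit z∈B with B-uncons z∈B
... | d , w , d-digit , w∈B , refl =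
  subst (B (suc n)) (sym (distrib u d w)) (B-cons (Digit-⊗ u-digit d-digit) (B-⊗-digit u-digit w∈B))
  where
  distrib : ∀ u d w → u ⊗ (d ⊕ ω ⊗ w) ≡ u ⊗ d ⊕ ω ⊗ (u ⊗ w)
  distrib = RingSolver.solve-∀ ℤ[i]-ring

-- A disc inside B n

radius : ℕ → ℤ
radius zero    = + 0
radius (suc n) = + 2 * radius n + + 1

radius-nonNeg : ∀ n → + 0 ≤ radius n
radius-nonNeg zero    = ℤP.≤-refl
radius-nonNeg (suc n) = ℤP.+-mono-≤ (ℤP.*-monoˡ-≤-nonNeg (+ 2) (radius-nonNeg n)) (+≤+ z≤n)

⟪_,_⟫ : ℤ[i] → ℤ[i] → ℤ
⟪ a + b i , c + d i ⟫ = a * c + b * d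

norm-⊖ : ∀ z u → norm z ≡ norm (z ⊖ u) + ((⟪ z , u ⟫ - norm u) + ⟪ z , u ⟫)
norm-⊖ (a + b i) (c + d i) = identity a b c d
  where
  identity : ∀ a b c d → a * a + b * b
           ≡ ((a - c) * (a - c) + (b - d) * (b - d)) + (((a * c + b * d) - (c * c + d * d)) + (a * c + b * d))
  identity = solve-∀

norm-⊖-aligned : ∀ z u → norm u ≤ ⟪ z , u ⟫ → norm (z ⊖ u) ≤ norm z
norm-⊖-aligned z u h =
  ≤-by-gap _ (ℤP.+-mono-≤ (ℤP.i≤j⇒0≤j-i h) (ℤP.≤-trans (norm-nonNeg u) h)) (norm-⊖ z u)

sign-cases : ∀ a → a ≡ + 0 ⊎ + 1 ≤ a ⊎ + 1 ≤ - a
sign-cases (+ zero)  = inj₁ refl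
sign-cases (+ suc n) = inj₂ (inj₁ (+≤+ (s≤s z≤n)))
sign-cases -[1+ n ]  = inj₂ (inj₂ (+≤+ (s≤s z≤n)))

⟪⟫-units : ∀ x y → (x ≡ x * + 1 + y * + 0) × (- x ≡ x * -[1+ 0 ] + y * + 0)
                      × (y ≡ x * + 0 + y * + 1) × (- y ≡ x * + 0 + y * -[1+ 0 ])
⟪⟫-units x y = dot-𝟙 x y , dot--𝟙 x y , dot-𝕚 x y , dot--𝕚 x y
  where
  dot-𝟙 : ∀ x y → x ≡ x * + 1 + y * + 0
  dot-𝟙 = solve-∀
  dot--𝟙 : ∀ x y → - x ≡ x * -[1+ 0 ] + y * + 0
  dot--𝟙 = solve-∀
  dot-𝕚 : ∀ x y → y ≡ x * + 0 + y * + 1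
  dot-𝕚 = solve-∀
  dot--𝕚 : ∀ x y → - y ≡ x * + 0 + y * -[1+ 0 ]
  dot--𝕚 = solve-∀

aligned-unit : ∀ z → z ≢ 𝟘 → ∃[ u ] Unit u × norm u ≤ ⟪ z , u ⟫
aligned-unit (x + y i) z≢𝟘 with sign-cases x | sign-cases y | ⟪⟫-units x y
... | inj₂ (inj₁ 1≤x)  | _                | e , _ = 𝟙 , is-𝟙 , ℤP.≤-trans 1≤x (ℤP.≤-reflexive e)
... | inj₂ (inj₂ 1≤-x) | _                | _ , e , _ = -𝟙 , is--𝟙 , ℤP.≤-trans 1≤-x (ℤP.≤-reflexive e)
... | inj₁ refl        | inj₂ (inj₁ 1≤y)  | _ , _ , e , _ = 𝕚 , is-𝕚 , ℤP.≤-trans 1≤y (ℤP.≤-reflexive e)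
... | inj₁ refl        | inj₂ (inj₂ 1≤-y) | _ , _ , _ , e = -𝕚 , is--𝕚 , ℤP.≤-trans 1≤-y (ℤP.≤-reflexive e)
... | inj₁ refl        | inj₁ refl        | _ = ⊥-elim (z≢𝟘 refl)

𝟙⊕ω⊗≢𝟘 : ∀ w → 𝟙 ⊕ ω ⊗ w ≢ 𝟘
𝟙⊕ω⊗≢𝟘 w eq = ω∤𝟙 (⊝ w) (begin
  𝟙                            ≡⟨ split w ⟩
  (𝟙 ⊕ ω ⊗ w) ⊕ ω ⊗ (⊝ w)      ≡⟨ cong (_⊕ ω ⊗ (⊝ w)) eq ⟩
  𝟘 ⊕ ω ⊗ (⊝ w)                ≡⟨ ⊕-identityˡ (ω ⊗ (⊝ w)) ⟩
  ω ⊗ (⊝ w)                    ∎)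
  where
  open ≡-Reasoning
  split : ∀ w → 𝟙 ≡ (𝟙 ⊕ ω ⊗ w) ⊕ ω ⊗ (⊝ w)
  split = RingSolver.solve-∀ ℤ[i]-ring

odd≢𝟘 : ∀ {z} w → z ≡ 𝟙 ⊕ ω ⊗ w → z ≢ 𝟘
odd≢𝟘 w z≡1+ωw z≡𝟘 = 𝟙⊕ω⊗≢𝟘 w (trans (sym z≡1+ωw) z≡𝟘)

Peeled : ℤ[i] → Set
Peeled z = ∃[ d ] ∃[ w ] Digit d × z ≡ d ⊕ ω ⊗ w × + 2 * norm w ≤ norm z

peel-aligned-unit : ∀ {z} w → z ≡ 𝟙 ⊕ ω ⊗ w → ∃[ u ] Unit u × norm u ≤ ⟪ z , u ⟫ → Peeled z
peel-aligned-unit {z} w z≡1+ωw (u , unit , aligned) with Unit-≡𝟙-mod-ω unit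
... | c , 𝟙≡u+ωc = u , c ⊕ w , inj₂ unit , z≡u+ω[c+w] , bound
  where
  regroup : ∀ u c w → (u ⊕ ω ⊗ c) ⊕ ω ⊗ w ≡ u ⊕ ω ⊗ (c ⊕ w)
  regroup = RingSolver.solve-∀ ℤ[i]-ring
  cancel : ∀ u x → x ≡ (u ⊕ x) ⊖ u
  cancel = RingSolver.solve-∀ ℤ[i]-ring
  z≡u+ω[c+w] : z ≡ u ⊕ ω ⊗ (c ⊕ w)
  z≡u+ω[c+w] = trans z≡1+ωw (trans (cong (_⊕ ω ⊗ w) 𝟙≡u+ωc) (regroup u c w))
  open ℤP.≤-Reasoning
  bound : + 2 * norm (c ⊕ w) ≤ norm z
  bound = begin
    + 2 * norm (c ⊕ w)   ≡⟨ norm-⊗ ω (c ⊕ w) ⟨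
    norm (ω ⊗ (c ⊕ w))   ≡⟨ cong norm (trans (cancel u _) (cong (_⊖ u) (sym z≡u+ω[c+w]))) ⟩
    norm (z ⊖ u)         ≤⟨ norm-⊖-aligned z u aligned ⟩
    norm z               ∎

peel-digit : ∀ z → Peeled z
peel-digit z with ω-split z
... | inj₁ (w , z≡ωw) =
  𝟘 , w , is-𝟘 , trans z≡ωw (sym (⊕-identityˡ (ω ⊗ w))) ,
  ℤP.≤-reflexive (trans (sym (norm-⊗ ω w)) (cong norm (sym z≡ωw)))
... | inj₂ (w , z≡1+ωw) = peel-aligned-unit w z≡1+ωw (aligned-unit z (odd≢𝟘 w z≡1+ωw))

disc : ∀ n z → norm z ≤ radius (suc n) → B n z
disc zero z h with peel-digit z
... | d , w , d-digit , refl , bound with norm≤0⇒≡𝟘 w (scaled-≤⇒≤ 1 (ℤP.≤-trans bound h))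
...   | refl = subst (B 0) (sym (⊕-ω⊗𝟘 d)) (Digit⇒B0 d-digit)
disc (suc n) z h with peel-digit z
... | d , w , d-digit , refl , bound = B-cons d-digit (disc n w (scaled-≤⇒≤ 1 (ℤP.≤-trans bound h)))

-- An octagon around B n

𝕚⊗ : ∀ x y → 𝕚 ⊗ (x + y i) ≡ (- y) + x i
𝕚⊗ x y = cong₂ _+_i (re≡ x y) (im≡ x y)
  where
  re≡ : ∀ x y → + 0 * x - + 1 * y ≡ - y
  re≡ = solve-∀
  im≡ : ∀ x y → + 0 * y + + 1 * x ≡ x
  im≡ = solve-∀

-𝕚⊗ : ∀ x y → -𝕚 ⊗ (x + y i) ≡ y + (- x) i
-𝕚⊗ x y = cong₂ _+_i (re≡ x y) (im≡ x y)
  where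
  re≡ : ∀ x y → + 0 * x - -[1+ 0 ] * y ≡ y
  re≡ = solve-∀
  im≡ : ∀ x y → + 0 * y + -[1+ 0 ] * x ≡ - x
  im≡ = solve-∀

-𝟙⊗ : ∀ x y → -𝟙 ⊗ (x + y i) ≡ (- x) + (- y) i
-𝟙⊗ x y = cong₂ _+_i (re≡ x y) (im≡ x y)
  where
  re≡ : ∀ x y → -[1+ 0 ] * x - + 0 * y ≡ - x
  re≡ = solve-∀
  im≡ : ∀ x y → -[1+ 0 ] * y + + 0 * x ≡ - y
  im≡ = solve-∀

ω̄⊗ : ∀ x y → ω̄ ⊗ (x + y i) ≡ (x + y) + (y - x) i
ω̄⊗ x y = cong₂ _+_i (re≡ x y) (im≡ x y)
  where
  re≡ : ∀ x y → + 1 * x - -[1+ 0 ] * y ≡ x + y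
  re≡ = solve-∀
  im≡ : ∀ x y → + 1 * y + -[1+ 0 ] * x ≡ y - x
  im≡ = solve-∀

rotate-to-first-quadrant : ∀ z → ∃[ u ] ∃[ a ] ∃[ b ] Unit u × + 0 ≤ a × + 0 ≤ b × u ⊗ z ≡ a + b i
rotate-to-first-quadrant (x + y i) with ℤP.≤-total (+ 0) x | ℤP.≤-total (+ 0) y
... | inj₁ 0≤x | inj₁ 0≤y = 𝟙 , x , y , is-𝟙 , 0≤x , 0≤y , ⊗-identityˡ (x + y i)
... | inj₂ x≤0 | inj₁ 0≤y = -𝕚 , y , - x , is--𝕚 , 0≤y , ℤP.neg-mono-≤ x≤0 , -𝕚⊗ x y
... | inj₂ x≤0 | inj₂ y≤0 = -𝟙 , - x , - y , is--𝟙 , ℤP.neg-mono-≤ x≤0 , ℤP.neg-mono-≤ y≤0 , -𝟙⊗ x y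
... | inj₁ 0≤x | inj₂ y≤0 = 𝕚 , - y , x , is-𝕚 , ℤP.neg-mono-≤ y≤0 , 0≤x , 𝕚⊗ x y

-- The octagon  |x| ≤ m, |y| ≤ m, |x| + |y| ≤ s  as eight half-planes: rotating z = x + y i by the
-- four units gives the real parts ±x, ±y, and rotating ω̄ ⊗ z = (x + y) + (y - x) i gives ±x ± y.
InOctagon : ℤ → ℤ → ℤ[i] → Set
InOctagon m s z = ∀ {u} → Unit u → re (u ⊗ z) ≤ m × re (u ⊗ (ω̄ ⊗ z)) ≤ s

re-digit-≤1 : ∀ {e} → Digit e → re e ≤ + 1
re-digit-≤1 is-𝟘        = +≤+ z≤n
re-digit-≤1 (inj₂ is-𝟙)  = +≤+ (s≤s z≤n)
re-digit-≤1 (inj₂ is--𝟙) = -≤+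
re-digit-≤1 (inj₂ is-𝕚)  = +≤+ z≤n
re-digit-≤1 (inj₂ is--𝕚) = +≤+ z≤n

re-ω̄⊗digit-≤1 : ∀ {e} → Digit e → re (ω̄ ⊗ e) ≤ + 1
re-ω̄⊗digit-≤1 is-𝟘        = +≤+ z≤n
re-ω̄⊗digit-≤1 (inj₂ is-𝟙)  = +≤+ (s≤s z≤n)
re-ω̄⊗digit-≤1 (inj₂ is--𝟙) = -≤+
re-ω̄⊗digit-≤1 (inj₂ is-𝕚)  = +≤+ (s≤s z≤n)
re-ω̄⊗digit-≤1 (inj₂ is--𝕚) = -≤+

digit-in-octagon : ∀ {d} → Digit d → InOctagon (+ 1) (+ 1) d
digit-in-octagon {d} d-digit {u} unit =
  re-digit-≤1 ud-digit , subst (λ t → re t ≤ + 1) (rotate u d) (re-ω̄⊗digit-≤1 ud-digit)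
  where
  ud-digit = Digit-⊗ (inj₂ unit) d-digit
  rotate : ∀ u d → ω̄ ⊗ (u ⊗ d) ≡ u ⊗ (ω̄ ⊗ d)
  rotate = RingSolver.solve-∀ ℤ[i]-ring

InOctagon-⊗-unit : ∀ {m s v z} → Unit v → InOctagon m s z → InOctagon m s (v ⊗ z)
InOctagon-⊗-unit {m} {s} {v} {z} v-unit z-oct {u} unit =
  subst (_≤ m) (cong re (⊗-assoc u v z)) (proj₁ (z-oct (Unit-⊗ unit v-unit))) ,
  subst (_≤ s) (cong re (regroup u v z)) (proj₂ (z-oct (Unit-⊗ unit v-unit)))
  where
  regroup : ∀ u v z → (u ⊗ v) ⊗ (ω̄ ⊗ z) ≡ u ⊗ (ω̄ ⊗ (v ⊗ z))
  regroup = RingSolver.solve-∀ ℤ[i]-ring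

-- ω = 𝕚 ⊗ ω̄ and ω̄ ⊗ ω = 2: one more digit moves the first family of half-planes onto the
-- second one and doubles the second.
octagon-step : ∀ {m s m′ s′ d b} → + 1 + s ≤ m′ → + 1 + (m + m) ≤ s′ →
               Digit d → InOctagon m s b → InOctagon m′ s′ (d ⊕ ω ⊗ b)
octagon-step {m} {s} {m′} {s′} {d} {b} s-bound m-bound d-digit b-oct {u} unit =
  (begin
    re (u ⊗ (d ⊕ ω ⊗ b))                          ≡⟨ cong re (expand₁ u d b) ⟩
    re (u ⊗ d) + re ((u ⊗ 𝕚) ⊗ (ω̄ ⊗ b))           ≤⟨ ℤP.+-mono-≤ (proj₁ d-oct) (proj₂ (b-oct (Unit-⊗ unit is-𝕚))) ⟩
    + 1 + s                                        ≤⟨ s-bound ⟩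
    m′                                             ∎) ,
  (begin
    re (u ⊗ (ω̄ ⊗ (d ⊕ ω ⊗ b)))                    ≡⟨ cong re (expand₂ u d b) ⟩
    re (u ⊗ (ω̄ ⊗ d)) + (re (u ⊗ b) + re (u ⊗ b))  ≤⟨ ℤP.+-mono-≤ (proj₂ d-oct) (ℤP.+-mono-≤ b-re b-re) ⟩
    + 1 + (m + m)                                  ≤⟨ m-bound ⟩
    s′                                             ∎)
  where
  open ℤP.≤-Reasoning
  d-oct = digit-in-octagon d-digit unit
  b-re = proj₁ (b-oct unit)
  expand₁ : ∀ u d b → u ⊗ (d ⊕ ω ⊗ b) ≡ u ⊗ d ⊕ (u ⊗ 𝕚) ⊗ (ω̄ ⊗ b)
  expand₁ = RingSolver.solve-∀ ℤ[i]-ring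
  expand₂ : ∀ u d b → u ⊗ (ω̄ ⊗ (d ⊕ ω ⊗ b)) ≡ u ⊗ (ω̄ ⊗ d) ⊕ (u ⊗ b ⊕ u ⊗ b)
  expand₂ = RingSolver.solve-∀ ℤ[i]-ring

-- With q = radius k = 2ᵏ - 1; two more digits double both m + 2 and s + 3.
B-even-octagon : ∀ k {z} → B (k ℕ.+ k) z →
                 InOctagon (+ 3 * radius k + + 1) (+ 4 * radius k + + 1) z
B-odd-octagon  : ∀ k {z} → B (suc (k ℕ.+ k)) z →
                 InOctagon (+ 4 * radius k + + 2) (+ 6 * radius k + + 3) z

B-even-octagon zero    z∈B = digit-in-octagon (B0⇒Digit z∈B)
B-even-octagon (suc k) {z} z∈B with B-uncons (subst (λ n → B n z) (ℕP.+-suc (suc k) k) z∈B)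
... | d , w , d-digit , w∈B , refl =
  octagon-step (ℤP.≤-reflexive (m-step (radius k))) (ℤP.≤-reflexive (s-step (radius k)))
               d-digit (B-odd-octagon k w∈B)
  where
  m-step : ∀ q → + 1 + (+ 6 * q + + 3) ≡ + 3 * (+ 2 * q + + 1) + + 1
  m-step = solve-∀
  s-step : ∀ q → + 1 + ((+ 4 * q + + 2) + (+ 4 * q + + 2)) ≡ + 4 * (+ 2 * q + + 1) + + 1
  s-step = solve-∀

B-odd-octagon k z∈B with B-uncons z∈B
... | d , w , d-digit , w∈B , refl =
  octagon-step (ℤP.≤-reflexive (m-step (radius k))) (ℤP.≤-reflexive (s-step (radius k)))
               d-digit (B-even-octagon k w∈B)
  where
  m-step : ∀ q → + 1 + (+ 4 * q + + 1) ≡ + 4 * q + + 2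
  m-step = solve-∀
  s-step : ∀ q → + 1 + ((+ 3 * q + + 1) + (+ 3 * q + + 1)) ≡ + 6 * q + + 3
  s-step = solve-∀

-- x² + y² is maximal at a vertex (M, U) of the region: if both coordinates exceed U, moving mass
-- from b to a increases the sum of squares, since M² - a² = (M - a)(M + a) ≥ (b - U)(b + U) = b² - U².
squares-bound : ∀ {a b M U} → + 0 ≤ a → + 0 ≤ b → + 0 ≤ U → a ≤ M → b ≤ M → a + b ≤ M + U →
                a * a + b * b ≤ M * M + U * U
squares-bound {a} {b} {M} {U} 0≤a 0≤b 0≤U a≤M b≤M a+b≤M+U with ℤP.≤-total a U | ℤP.≤-total b U
... | inj₁ a≤U | _ = ℤP.≤-trans (ℤP.+-mono-≤ (square-mono 0≤a a≤U) (square-mono 0≤b b≤M))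
                                 (ℤP.≤-reflexive (ℤP.+-comm (U * U) (M * M)))
... | inj₂ U≤a | inj₁ b≤U = ℤP.+-mono-≤ (square-mono 0≤a a≤M) (square-mono 0≤b b≤U)
... | inj₂ U≤a | inj₂ U≤b = ≤-by-gap _ (ℤP.i≤j⇒0≤j-i exchange) (gap-identity a b M U)
  where
  gap-identity : ∀ a b M U → M * M + U * U ≡ (a * a + b * b) + ((M - a) * (M + a) - (b - U) * (b + U))
  gap-identity = solve-∀
  shift : ∀ a b M U → M - a ≡ (b - U) + ((M + U) - (a + b))
  shift = solve-∀
  exchange : (b - U) * (b + U) ≤ (M - a) * (M + a)
  exchange = mul-mono-nonNeg (ℤP.i≤j⇒0≤j-i U≤b) (ℤP.+-mono-≤ 0≤b 0≤U)
    (≤-by-gap _ (ℤP.i≤j⇒0≤j-i a+b≤M+U) (shift a b M U)) (ℤP.+-mono-≤ b≤M U≤a)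

norm-2α-ω : ∀ x y → norm (((x + y i) ⊕ (x + y i)) ⊖ ω) ≡ + 4 * norm (x + y i) + + 4 * (- (x + y)) + + 2
norm-2α-ω x y = identity x y
  where
  identity : ∀ x y → ((x + x) - + 1) * ((x + x) - + 1) + ((y + y) - + 1) * ((y + y) - + 1)
                   ≡ + 4 * (x * x + y * y) + + 4 * (- (x + y)) + + 2
  identity = solve-∀

octagon-norm-bound : ∀ {M U S α} → + 0 ≤ U → S ≤ M + U → InOctagon M S α →
                     norm ((α ⊕ α) ⊖ ω) ≤ + 4 * (M * M + U * U) + + 4 * S + + 2
octagon-norm-bound {M} {U} {S} {x + y i} 0≤U S≤M+U α-oct = begin
  norm (((x + y i) ⊕ (x + y i)) ⊖ ω)               ≡⟨ norm-2α-ω x y ⟩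
  + 4 * norm (x + y i) + + 4 * (- (x + y)) + + 2  ≤⟨ ℤP.+-monoˡ-≤ (+ 2) (ℤP.+-mono-≤
                                                        (ℤP.*-monoˡ-≤-nonNeg (+ 4) norm≤)
                                                        (ℤP.*-monoˡ-≤-nonNeg (+ 4) -[x+y]≤S)) ⟩
  + 4 * (M * M + U * U) + + 4 * S + + 2           ∎
  where
  open ℤP.≤-Reasoning
  -[x+y]≤S : - (x + y) ≤ S
  -[x+y]≤S = subst (_≤ S) (cong re (trans (cong (-𝟙 ⊗_) (ω̄⊗ x y)) (-𝟙⊗ (x + y) (y - x))))
                   (proj₂ (α-oct is--𝟙))
  norm≤ : norm (x + y i) ≤ M * M + U * U
  norm≤ with rotate-to-first-quadrant (x + y i)
  ... | u , a , b , unit , 0≤a , 0≤b , uα≡a+bi = begin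
    norm (x + y i)       ≡⟨ norm-⊗-unit (x + y i) unit ⟨
    norm (u ⊗ (x + y i)) ≡⟨ cong norm uα≡a+bi ⟩
    a * a + b * b        ≤⟨ squares-bound 0≤a 0≤b 0≤U a≤M b≤M (ℤP.≤-trans a+b≤S S≤M+U) ⟩
    M * M + U * U        ∎
    where
    β-oct : InOctagon M S (a + b i)
    β-oct = subst (InOctagon M S) uα≡a+bi (InOctagon-⊗-unit unit α-oct)
    a≤M : a ≤ M
    a≤M = subst (_≤ M) (cong re (⊗-identityˡ (a + b i))) (proj₁ (β-oct is-𝟙))
    b≤M : b ≤ M
    b≤M = subst (_≤ M) (cong re (-𝕚⊗ a b)) (proj₁ (β-oct is--𝕚))
    a+b≤S : a + b ≤ S
    a+b≤S = subst (_≤ S) (cong re (trans (⊗-identityˡ _) (ω̄⊗ a b))) (proj₂ (β-oct is-𝟙))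

radius-double : ∀ k → radius (k ℕ.+ k) ≡ radius k * (radius k + + 2)
radius-double zero    = refl
radius-double (suc k) = begin
  radius (suc k ℕ.+ suc k)                      ≡⟨ cong radius (ℕP.+-suc (suc k) k) ⟩
  + 2 * (+ 2 * radius (k ℕ.+ k) + + 1) + + 1    ≡⟨ cong (λ r → + 2 * (+ 2 * r + + 1) + + 1) (radius-double k) ⟩
  + 2 * (+ 2 * (q * (q + + 2)) + + 1) + + 1     ≡⟨ identity q ⟩
  (+ 2 * q + + 1) * ((+ 2 * q + + 1) + + 2)     ∎
  where
  open ≡-Reasoning
  q = radius k
  identity : ∀ q → + 2 * (+ 2 * (q * (q + + 2)) + + 1) + + 1 ≡ (+ 2 * q + + 1) * ((+ 2 * q + + 1) + + 2)
  identity = solve-∀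

parity : ∀ n → (∃[ k ] n ≡ k ℕ.+ k) ⊎ (∃[ k ] n ≡ suc (k ℕ.+ k))
parity zero    = inj₁ (0 , refl)
parity (suc n) with parity n
... | inj₁ (k , refl) = inj₂ (k , refl)
... | inj₂ (k , refl) = inj₁ (suc k , cong suc (sym (ℕP.+-suc k k)))

B-norm-bound : ∀ n {α} → B n α → norm ((α ⊕ α) ⊖ ω) ≤ + 10 * radius (suc (suc n)) + + 9
B-norm-bound n α∈B with parity n
... | inj₁ (k , refl) = ℤP.≤-trans
  (octagon-norm-bound (radius-nonNeg k) (ℤP.≤-reflexive (split (radius k))) (B-even-octagon k α∈B))
  (≤-by-gap _ (ℤP.+-mono-≤ (ℤP.*-monoˡ-≤-nonNeg (+ 40) (radius-nonNeg k)) (+≤+ z≤n)) (begin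
    + 10 * (+ 2 * (+ 2 * radius (k ℕ.+ k) + + 1) + + 1) + + 9
      ≡⟨ cong (λ r → + 10 * (+ 2 * (+ 2 * r + + 1) + + 1) + + 9) (radius-double k) ⟩
    + 10 * (+ 2 * (+ 2 * (q * (q + + 2)) + + 1) + + 1) + + 9
      ≡⟨ gap-identity q ⟩
    + 4 * ((+ 3 * q + + 1) * (+ 3 * q + + 1) + q * q) + + 4 * (+ 4 * q + + 1) + + 2 + (+ 40 * q + + 29) ∎))
  where
  open ≡-Reasoning
  q = radius k
  split : ∀ q → + 4 * q + + 1 ≡ (+ 3 * q + + 1) + q
  split = solve-∀
  gap-identity : ∀ q → + 10 * (+ 2 * (+ 2 * (q * (q + + 2)) + + 1) + + 1) + + 9
    ≡ + 4 * ((+ 3 * q + + 1) * (+ 3 * q + + 1) + q * q) + + 4 * (+ 4 * q + + 1) + + 2 + (+ 40 * q + + 29)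
  gap-identity = solve-∀
... | inj₂ (k , refl) = ℤP.≤-trans
  (octagon-norm-bound (radius-nonNeg (suc k)) (ℤP.≤-reflexive (split (radius k))) (B-odd-octagon k α∈B))
  (≤-by-gap _ (ℤP.+-mono-≤ (ℤP.*-monoˡ-≤-nonNeg (+ 56) (radius-nonNeg k)) (+≤+ z≤n)) (begin
    + 10 * (+ 2 * (+ 2 * (+ 2 * radius (k ℕ.+ k) + + 1) + + 1) + + 1) + + 9
      ≡⟨ cong (λ r → + 10 * (+ 2 * (+ 2 * (+ 2 * r + + 1) + + 1) + + 1) + + 9) (radius-double k) ⟩
    + 10 * (+ 2 * (+ 2 * (+ 2 * (q * (q + + 2)) + + 1) + + 1) + + 1) + + 9
      ≡⟨ gap-identity q ⟩
    + 4 * ((+ 4 * q + + 2) * (+ 4 * q + + 2) + (+ 2 * q + + 1) * (+ 2 * q + + 1)) + + 4 * (+ 6 * q + + 3) + + 2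
      + (+ 56 * q + + 45) ∎))
  where
  open ≡-Reasoning
  q = radius k
  split : ∀ q → + 6 * q + + 3 ≡ (+ 4 * q + + 2) + (+ 2 * q + + 1)
  split = solve-∀
  gap-identity : ∀ q → + 10 * (+ 2 * (+ 2 * (+ 2 * (q * (q + + 2)) + + 1) + + 1) + + 1) + + 9
    ≡ + 4 * ((+ 4 * q + + 2) * (+ 4 * q + + 2) + (+ 2 * q + + 1) * (+ 2 * q + + 1)) + + 4 * (+ 6 * q + + 3) + + 2
      + (+ 56 * q + + 45)
  gap-identity = solve-∀

-- Covering residue classes

pronic-cases : ∀ k → k ≡ + 0 ⊎ k ≡ + 1 ⊎ + 2 ≤ k * (k - + 1)
pronic-cases (+ zero)        = inj₁ refl
pronic-cases (+ suc zero)    = inj₂ (inj₁ refl)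
pronic-cases (+ suc (suc n)) =
  inj₂ (inj₂ (mul-mono-nonNeg {+ 2} {+ suc (suc n)} {+ 1} {+ suc (suc n) - + 1}
    (+≤+ z≤n) (+≤+ z≤n) (+≤+ (s≤s (s≤s z≤n))) (+≤+ (s≤s z≤n))))
pronic-cases -[1+ n ]        =
  inj₂ (inj₂ (subst (+ 2 ≤_) (reflect -[1+ n ])
    (mul-mono-nonNeg {+ 1} {+ suc n} {+ 2} {+ 1 + + suc n}
      (+≤+ z≤n) (+≤+ z≤n) (+≤+ (s≤s z≤n)) (+≤+ (s≤s (s≤s z≤n))))))
  where
  reflect : ∀ k → (- k) * (+ 1 + - k) ≡ k * (k - + 1)
  reflect = solve-∀

pronic-nonNeg : ∀ k → + 0 ≤ k * (k - + 1)
pronic-nonNeg k with pronic-cases k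
... | inj₁ refl        = +≤+ z≤n
... | inj₂ (inj₁ refl) = +≤+ z≤n
... | inj₂ (inj₂ 2≤p)  = ℤP.≤-trans (+≤+ z≤n) 2≤p

norm-ω⊖2κ : ∀ k₁ k₂ → norm (ω ⊖ ((k₁ + k₂ i) ⊕ (k₁ + k₂ i)))
                    ≡ + 2 + + 4 * (k₁ * (k₁ - + 1) + k₂ * (k₂ - + 1))
norm-ω⊖2κ k₁ k₂ = identity k₁ k₂
  where
  identity : ∀ k₁ k₂ → (+ 1 - (k₁ + k₁)) * (+ 1 - (k₁ + k₁)) + (+ 1 - (k₂ + k₂)) * (+ 1 - (k₂ + k₂))
                     ≡ + 2 + + 4 * (k₁ * (k₁ - + 1) + k₂ * (k₂ - + 1))
  identity = solve-∀

norm-ω⊖2κ-≥10 : ∀ k₁ k₂ → + 2 ≤ k₁ * (k₁ - + 1) + k₂ * (k₂ - + 1) →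
                 + 10 ≤ norm (ω ⊖ ((k₁ + k₂ i) ⊕ (k₁ + k₂ i)))
norm-ω⊖2κ-≥10 k₁ k₂ h =
  subst (+ 10 ≤_) (sym (norm-ω⊖2κ k₁ k₂)) (ℤP.+-monoʳ-≤ (+ 2) (ℤP.*-monoˡ-≤-nonNeg (+ 4) h))

ω⊖2κ-unit-or-large : ∀ κ → (∃[ v ] Unit v × ω ⊖ (κ ⊕ κ) ≡ v ⊗ ω) ⊎ + 10 ≤ norm (ω ⊖ (κ ⊕ κ))
ω⊖2κ-unit-or-large (k₁ + k₂ i) with pronic-cases k₁ | pronic-cases k₂
... | inj₁ refl        | inj₁ refl        = inj₁ (𝟙 , is-𝟙 , refl)
... | inj₂ (inj₁ refl) | inj₁ refl        = inj₁ (𝕚 , is-𝕚 , refl)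
... | inj₁ refl        | inj₂ (inj₁ refl) = inj₁ (-𝕚 , is--𝕚 , refl)
... | inj₂ (inj₁ refl) | inj₂ (inj₁ refl) = inj₁ (-𝟙 , is--𝟙 , refl)
... | inj₂ (inj₂ 2≤p₁) | _ = inj₂ (norm-ω⊖2κ-≥10 k₁ k₂ (ℤP.+-mono-≤ 2≤p₁ (pronic-nonNeg k₂)))
... | _ | inj₂ (inj₂ 2≤p₂) = inj₂ (norm-ω⊖2κ-≥10 k₁ k₂ (ℤP.+-mono-≤ (pronic-nonNeg k₁) 2≤p₂))

Covers : ℕ → ℤ[i] → Set
Covers n β = ∀ γ → ∃[ α ] B n α × β ∣ (γ ⊖ α)

⊖≡𝟘⇒≡ : ∀ {x y} → x ⊖ y ≡ 𝟘 → x ≡ y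
⊖≡𝟘⇒≡ {x} {y} eq = begin
  x             ≡⟨ regroup x y ⟩
  (x ⊖ y) ⊕ y   ≡⟨ cong (_⊕ y) eq ⟩
  𝟘 ⊕ y         ≡⟨ ⊕-identityˡ y ⟩
  y             ∎
  where
  open ≡-Reasoning
  regroup : ∀ x y → x ≡ (x ⊖ y) ⊕ y
  regroup = RingSolver.solve-∀ ℤ[i]-ring

ω⊗-congruence : ∀ γ b δ κ {d} → Digit d → ω ⊗ γ ⊖ (d ⊕ ω ⊗ b) ≡ (ω ⊗ δ) ⊗ κ → γ ⊖ b ≡ δ ⊗ κ
ω⊗-congruence γ b δ κ {d} d-digit eq = ⊖≡𝟘⇒≡ (ω⊗-cancelˡ (begin
  ω ⊗ (γ ⊖ b ⊖ δ ⊗ κ)   ≡⟨ d≡ω[γ-b-δκ] ⟨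
  d                     ≡⟨ ω∣digit⇒≡𝟘 (γ ⊖ b ⊖ δ ⊗ κ) d-digit d≡ω[γ-b-δκ] ⟩
  𝟘                     ≡⟨ ⊗-zeroʳ ω ⟨
  ω ⊗ 𝟘                 ∎))
  where
  open ≡-Reasoning
  split : ∀ γ b d → d ≡ ω ⊗ (γ ⊖ b) ⊖ (ω ⊗ γ ⊖ (d ⊕ ω ⊗ b))
  split = RingSolver.solve-∀ ℤ[i]-ring
  factor : ∀ γ b δ κ → ω ⊗ (γ ⊖ b) ⊖ (ω ⊗ δ) ⊗ κ ≡ ω ⊗ (γ ⊖ b ⊖ δ ⊗ κ)
  factor = RingSolver.solve-∀ ℤ[i]-ring
  d≡ω[γ-b-δκ] : d ≡ ω ⊗ (γ ⊖ b ⊖ δ ⊗ κ)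
  d≡ω[γ-b-δκ] = begin
    d                                         ≡⟨ split γ b d ⟩
    ω ⊗ (γ ⊖ b) ⊖ (ω ⊗ γ ⊖ (d ⊕ ω ⊗ b))      ≡⟨ cong (ω ⊗ (γ ⊖ b) ⊖_) eq ⟩
    ω ⊗ (γ ⊖ b) ⊖ (ω ⊗ δ) ⊗ κ                ≡⟨ factor γ b δ κ ⟩
    ω ⊗ (γ ⊖ b ⊖ δ ⊗ κ)                      ∎

factor≤1 : ∀ {a b} → + 0 ≤ a → + 0 ≤ b → a * b ≡ + 1 → a ≤ + 1
factor≤1 {+ m} {+ n} _ _ eq =
  +≤+ (ℕP.≤-reflexive (ℕP.m*n≡1⇒m≡1 m n (trans (sym (ℤP.abs-* (+ m) (+ n))) (cong ∣_∣ eq))))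

-- The class of ω can only contain the digit 0, which forces δ to be a unit.
covers-ω⊗-zero : ∀ δ → Covers 0 (ω ⊗ δ) → B 0 δ
covers-ω⊗-zero δ cover with cover ω
... | α , α∈B , κ , ω-α≡ωδκ = disc 0 δ
  (factor≤1 (norm-nonNeg δ) (norm-nonNeg κ) (trans (sym (norm-⊗ δ κ)) (cong norm (sym 𝟙≡δκ))))
  where
  𝟙≡δκ : 𝟙 ≡ δ ⊗ κ
  𝟙≡δκ = ω⊗-congruence 𝟙 𝟘 δ κ (B0⇒Digit α∈B) (trans (cong (ω ⊖_) (⊕-ω⊗𝟘 α)) ω-α≡ωδκ)

covers-ω⊗-suc : ∀ n δ → Covers (suc n) (ω ⊗ δ) → Covers n δ
covers-ω⊗-suc n δ cover γ with cover (ω ⊗ γ)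
... | α , α∈B , κ , ωγ-α≡ωδκ with B-uncons α∈B
...   | d , b , d-digit , b∈B , refl = b , b∈B , κ , ω⊗-congruence γ b δ κ d-digit ωγ-α≡ωδκ

-- For odd β = 𝟙 ⊕ ω ⊗ w the class of γ = 𝕚 ⊗ w ⊕ ω is "ω / 2 modulo β", since 2γ - ω = ω β.
odd-residue-identity : ∀ w α κ {β} → β ≡ 𝟙 ⊕ ω ⊗ w → (𝕚 ⊗ w ⊕ ω) ⊖ α ≡ β ⊗ κ →
                       β ⊗ (ω ⊖ (κ ⊕ κ)) ≡ (α ⊕ α) ⊖ ω
odd-residue-identity w α κ {β} β≡ γ-α≡βκ = begin
  β ⊗ (ω ⊖ (κ ⊕ κ))                                     ≡⟨ expand β κ ⟩
  β ⊗ ω ⊖ (β ⊗ κ ⊕ β ⊗ κ)                               ≡⟨ cong₂ (λ s t → s ⊖ (t ⊕ t)) (cong (_⊗ ω) β≡) (sym γ-α≡βκ) ⟩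
  (𝟙 ⊕ ω ⊗ w) ⊗ ω ⊖ (((𝕚 ⊗ w ⊕ ω) ⊖ α) ⊕ ((𝕚 ⊗ w ⊕ ω) ⊖ α)) ≡⟨ collapse w α ⟩
  (α ⊕ α) ⊖ ω                                           ∎
  where
  open ≡-Reasoning
  expand : ∀ β κ → β ⊗ (ω ⊖ (κ ⊕ κ)) ≡ β ⊗ ω ⊖ (β ⊗ κ ⊕ β ⊗ κ)
  expand = RingSolver.solve-∀ ℤ[i]-ring
  collapse : ∀ w α → (𝟙 ⊕ ω ⊗ w) ⊗ ω ⊖ (((𝕚 ⊗ w ⊕ ω) ⊖ α) ⊕ ((𝕚 ⊗ w ⊕ ω) ⊖ α)) ≡ (α ⊕ α) ⊖ ω
  collapse = RingSolver.solve-∀ ℤ[i]-ring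

-- Dividing β ⊗ v ⊗ ω = 2α - ω by ω gives the digit expansion β ⊗ v = -𝟙 ⊕ ω ⊗ (-𝕚 ⊗ α).
odd-unit-case : ∀ n α β κ {v} → B n α → β ⊗ (ω ⊖ (κ ⊕ κ)) ≡ (α ⊕ α) ⊖ ω →
                Unit v → ω ⊖ (κ ⊕ κ) ≡ v ⊗ ω → B (suc n) β
odd-unit-case n α β κ {v} α∈B key v-unit μ≡vω with Unit-inverse v-unit
... | v′ , v′-unit , v′v≡𝟙 = subst (B (suc n)) unrotate (B-⊗-digit (inj₂ v′-unit) βv∈B)
  where
  open ≡-Reasoning
  rearrange : ∀ β v → ω ⊗ (β ⊗ v) ≡ β ⊗ (v ⊗ ω)
  rearrange = RingSolver.solve-∀ ℤ[i]-ring
  halve : ∀ α → (α ⊕ α) ⊖ ω ≡ ω ⊗ (-𝟙 ⊕ ω ⊗ (-𝕚 ⊗ α))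
  halve = RingSolver.solve-∀ ℤ[i]-ring
  reassociate : ∀ β v v′ → v′ ⊗ (β ⊗ v) ≡ β ⊗ (v′ ⊗ v)
  reassociate = RingSolver.solve-∀ ℤ[i]-ring
  βv≡ : β ⊗ v ≡ -𝟙 ⊕ ω ⊗ (-𝕚 ⊗ α)
  βv≡ = ω⊗-cancelˡ (begin
    ω ⊗ (β ⊗ v)              ≡⟨ rearrange β v ⟩
    β ⊗ (v ⊗ ω)              ≡⟨ cong (β ⊗_) μ≡vω ⟨
    β ⊗ (ω ⊖ (κ ⊕ κ))        ≡⟨ key ⟩
    (α ⊕ α) ⊖ ω              ≡⟨ halve α ⟩
    ω ⊗ (-𝟙 ⊕ ω ⊗ (-𝕚 ⊗ α))  ∎)
  βv∈B : B (suc n) (β ⊗ v)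
  βv∈B = subst (B (suc n)) (sym βv≡) (B-cons (inj₂ is--𝟙) (B-⊗-digit (inj₂ is--𝕚) α∈B))
  unrotate : v′ ⊗ (β ⊗ v) ≡ β
  unrotate = begin
    v′ ⊗ (β ⊗ v)   ≡⟨ reassociate β v v′ ⟩
    β ⊗ (v′ ⊗ v)   ≡⟨ cong (β ⊗_) v′v≡𝟙 ⟩
    β ⊗ 𝟙          ≡⟨ ⊗-identityʳ β ⟩
    β              ∎

odd-large-case : ∀ n α β κ → B n α → β ⊗ (ω ⊖ (κ ⊕ κ)) ≡ (α ⊕ α) ⊖ ω →
                 + 10 ≤ norm (ω ⊖ (κ ⊕ κ)) → B (suc n) β
odd-large-case n α β κ α∈B key 10≤|μ| = disc (suc n) β (scaled-≤⇒≤ 9 (begin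
  + 10 * norm β                      ≤⟨ ℤP.*-monoʳ-≤-nonNeg (norm β) {{nonNegative (norm-nonNeg β)}} 10≤|μ| ⟩
  norm μ * norm β                    ≡⟨ ℤP.*-comm (norm μ) (norm β) ⟩
  norm β * norm μ                    ≡⟨ norm-⊗ β μ ⟨
  norm (β ⊗ μ)                       ≡⟨ cong norm key ⟩
  norm ((α ⊕ α) ⊖ ω)                 ≤⟨ B-norm-bound n α∈B ⟩
  + 10 * radius (suc (suc n)) + + 9  ∎))
  where
  open ℤP.≤-Reasoning
  μ = ω ⊖ (κ ⊕ κ)

covers-odd : ∀ n w {β} → β ≡ 𝟙 ⊕ ω ⊗ w → Covers n β → B (suc n) β
covers-odd n w {β} β≡ cover with cover (𝕚 ⊗ w ⊕ ω)
... | α , α∈B , κ , γ-α≡βκ with ω⊖2κ-unit-or-large κ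
...   | inj₁ (v , v-unit , μ≡vω) = odd-unit-case n α β κ α∈B key v-unit μ≡vω
  where key = odd-residue-identity w α κ β≡ γ-α≡βκ
...   | inj₂ 10≤|μ| = odd-large-case n α β κ α∈B key 10≤|μ|
  where key = odd-residue-identity w α κ β≡ γ-α≡βκ

covers⇒B : ∀ n β → Covers n β → B (suc n) β
covers⇒B n β cover with ω-split β
covers⇒B zero    β cover | inj₁ (δ , refl) = B-ω⊗ (covers-ω⊗-zero δ cover)
covers⇒B (suc n) β cover | inj₁ (δ , refl) = B-ω⊗ (covers⇒B n δ (covers-ω⊗-suc n δ cover))
covers⇒B n       β cover | inj₂ (w , β≡) = covers-odd n w β≡ cover

mainTheorem8 : (n : ℕ)
    → (∀ (z : ℤ[i]) → (A n z → B n z) × (B n z → A n z))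
    → ∀ (z : ℤ[i]) → A (suc n) z → B (suc n) z
mainTheorem8 n A⇔B z (inj₁ z∈A) = B-mono (proj₁ (A⇔B z) z∈A)
mainTheorem8 n A⇔B z (inj₂ z-covers-A) = covers⇒B n z z-covers-B
  where
  z-covers-B : Covers n z
  z-covers-B γ with z-covers-A γ
  ... | α , α∈A , z∣γ-α = α , proj₁ (A⇔B α) α∈A , z∣γ-α
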